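{- For $r\ge1$ let \[ F_r(w_1,\dots,w_r)=\sum_{n_1,\dots,n_r\ge0}\frac{w_1^{n_1}\cdots w_r^{n_r}}{n_1!\cdots n_r!}\,\zeta_r(-n_1,\dots,-n_r) \] (as a formal power series), and let $F_B(w)=\frac{w}{e^w-1}=\sum_{n\ge0}B_n\frac{w^n}{n!}$. Then \[ F_1(w_1)=\frac{1-F_B(-w_1)}{w_1}, \] and for $r\ge2$ \[ F_r(w_1,\dots,w_r)=\frac{1}{w_r}\Big[F_{r-1}(w_1,\dots,w_{r-1})-F_B(-w_r)\,F_{r-1}(w_1,\dots,w_{r-2},w_{r-1}+w_r)\Big]. \]
   Context: Bernoulli numbers $B_m$ are defined by $\frac{t}{e^t-1}=\sum_{m\ge0}B_m\frac{t^m}{m!}$. For positive integers $a_1,\dots,a_k$, define recursively $V(a_1)=B_{a_1}/a_1$ and, for $k\ge2$, \[ V(a_1,\dots,a_k)=\frac{1}{a_k}\sum_{j=0}^{a_k}\binom{a_k}{j}B_{a_k-j}V(a_1,\dots,a_{k-2},a_{k-1}+j). \] The multiple zeta values at negative integers (Sadaoui's analytic continuation of the Euler–Zagier multiple zeta function, in the paper's closed form) are \[ \zeta_r(-n_1,\dots,-n_r)=(-1)^{n_1+\dots+n_r}V(n_1+1,\dots,n_r+1) \] for nonnegative integers $n_i$. -}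

module Defs where

open import Data.Nat as ℕ using (ℕ; zero; suc; _∸_; _!)
open import Relation.Binary.PropositionalEquality using (_≡_)
open import Data.Nat.Combinatorics using (_C_)
open import Data.Nat.Properties using (_≟_)
open import Data.Integer using (+_)
open import Data.Rational using (ℚ; 0ℚ; 1ℚ; _+_; _*_; _-_; -_; _/_)
open import Data.List as List using (List; []; _∷_)
open import Data.Vec as Vec using (Vec; []; _∷_; _∷ʳ_; init; last)
open import Data.Vec.Properties using (≡-dec)
open import Data.Bool using (Bool; true; false; if_then_else_)
open import Relation.Nullary.Decidable using (does)

ℕ→ℚ : ℕ → ℚ
ℕ→ℚ n = + n / 1

-- 1/n for n ≥ 1 (value at 0 is irrelevant, never used)
recip : ℕ → ℚ
recip zero    = 0ℚ
recip (suc n) = + 1 / suc n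

sgn : ℕ → ℚ
sgn zero    = 1ℚ
sgn (suc n) = - sgn n

sumTo : ℕ → (ℕ → ℚ) → ℚ
sumTo zero    f = f 0
sumTo (suc n) f = sumTo n f + f (suc n)

nth : List ℚ → ℕ → ℚ
nth []       _       = 0ℚ
nth (x ∷ xs) zero    = x
nth (x ∷ xs) (suc i) = nth xs i

-- Bernoulli numbers (convention t/(e^t-1), so B_1 = -1/2) via
-- B_0 = 1,  B_m = -1/(m+1) Σ_{k=0}^{m-1} C(m+1,k) B_k.
-- bernList m = [B_0, …, B_m]
bernList : ℕ → List ℚ
bernList zero    = 1ℚ ∷ []
bernList (suc m) = bernList m List.++ (next ∷ [])
  where
  next : ℚ
  next = - (recip (suc (suc m)) * sumTo m (λ k → ℕ→ℚ (suc (suc m) C k) * nth (bernList m) k))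

B : ℕ → ℚ
B m = nth (bernList m) m

-- V on the reversed argument list: Vrev a [a_{k-1}, …, a_1] = V(a_1, …, a_{k-1}, a)
Vrev : ℕ → List ℕ → ℚ
Vrev a []         = B a * recip a
Vrev a (b ∷ rest) = recip a * sumTo a (λ j → ℕ→ℚ (a C j) * B (a ∸ j) * Vrev (b ℕ.+ j) rest)

V : ∀ {k} → Vec ℕ (suc k) → ℚ
V as = go (Vec.reverse as)
  where
  go : ∀ {k} → Vec ℕ (suc k) → ℚ
  go (a ∷ rest) = Vrev a (Vec.toList rest)

-- ζ_r(-n_1, …, -n_r) = (-1)^{n_1+…+n_r} V(n_1+1, …, n_r+1)
ζneg : ∀ {k} → Vec ℕ (suc k) → ℚ
ζneg ns = sgn (Vec.sum ns) * V (Vec.map suc ns)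

-- Formal power series in r variables over ℚ, given by their coefficient
-- function: f v is the coefficient of w_1^{v_1} ⋯ w_r^{v_r}.

PS : ℕ → Set
PS r = Vec ℕ r → ℚ

_≈ₛ_ : ∀ {r} → PS r → PS r → Set
f ≈ₛ g = ∀ v → f v ≡ g v

_+ₛ_ : ∀ {r} → PS r → PS r → PS r
(f +ₛ g) v = f v + g v

-ₛ_ : ∀ {r} → PS r → PS r
(-ₛ f) v = - f v

_-ₛ_ : ∀ {r} → PS r → PS r → PS r
f -ₛ g = f +ₛ (-ₛ g)

_*ₛ_ : ∀ {r} → PS r → PS r → PS r
(f *ₛ g) []      = f [] * g []
(f *ₛ g) (n ∷ v) = sumTo n (λ i → ((λ u → f (i ∷ u)) *ₛ (λ u → g ((n ∸ i) ∷ u))) v)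

mono : ∀ {r} → Vec ℕ r → PS r
mono m v = if does (≡-dec _≟_ v m) then 1ℚ else 0ℚ

oneₛ : ∀ {r} → PS r
oneₛ {r} = mono (Vec.replicate r 0)

lastVar : ∀ {k} → PS (suc k)
lastVar {k} = mono (Vec.replicate k 0 ∷ʳ 1)

inLast : ∀ {k} → (ℕ → ℚ) → PS (suc k)
inLast {k} h v = if does (≡-dec _≟_ (init v) (Vec.replicate k 0)) then h (last v) else 0ℚ

extendLast : ∀ {k} → PS k → PS (suc k)
extendLast f v = if does (last v ≟ 0) then f (init v) else 0ℚ

-- substitution: G(w_1,…,w_{k+1}) ↦ G(w_1,…,w_k, w_{k+1}+w_{k+2}),
-- coefficientwise: coefficient of w_{k+1}^a w_{k+2}^b is C(a+b,a)·g(…, a+b)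
substLast : ∀ {k} → PS (suc k) → PS (suc (suc k))
substLast g v = ℕ→ℚ ((a ℕ.+ b) C a) * g (init (init v) ∷ʳ (a ℕ.+ b))
  where
  a = last (init v)
  b = last v

FBneg : ℕ → ℚ
FBneg n = sgn n * B n * recip (n !)

-- F_r(w_1,…,w_r) for r = k+1:
-- coefficient of w^n is ζ_r(-n_1,…,-n_r) / (n_1! ⋯ n_r!)
F : (k : ℕ) → PS (suc k)
F k n = ζneg n * recip (Vec.foldr _ ℕ._*_ 1 (Vec.map _! n))

-- Coefficientwise, multiplication by w_r shifts the last exponent down by one.
-- After normalising every coefficient by the weights ε n = (-1)ⁿ/n!, the
-- coefficient of w^(p,a,m+1) on the left is the defining recursion of V, and
-- on the right the Cauchy product with F_B(-w_r) together with the substitution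
-- w_{r-1} ↦ w_{r-1} + w_r gives the same sum read backwards, thanks to the two
-- binomial identities  C(a+j,a) ε(a+j) = ε a ε j  and
-- ε m / (m+1) · C(m+1,j) = - ε j ε (m+1-j).  At last exponent 0 both sides vanish.
module Submission where

open import Data.Nat as ℕ using (ℕ; zero; suc; _∸_; _!; _≤_; NonZero)
import Data.Nat.Properties as ℕₚ
open import Data.Nat.Combinatorics using (_C_; nCk≡n!/k![n-k]!; k![n∸k]!∣n!; nCn≡1)
open import Data.Nat.DivMod using (m/n*n≡m)
open import Data.Integer as ℤ using (+_)
import Data.Integer.Properties as ℤₚ
open import Data.Rational using (ℚ; 0ℚ; 1ℚ; _+_; _*_; -_; toℚᵘ)
open import Data.Rational.Properties
import Data.Rational.Unnormalised as ℚᵘ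
import Data.Rational.Unnormalised.Properties as ℚᵘₚ
open import Data.Rational.Solver using (module +-*-Solver)
open import Data.List using (List; _∷_)
open import Data.Vec as Vec using (Vec; []; _∷_; _∷ʳ_)
import Data.Vec.Properties as Vecₚ
open import Data.Product using (_×_; _,_)
open import Algebra.Structures using (IsMonoid)
open import Relation.Binary.PropositionalEquality
open import Defs

open +-*-Solver

ℕ→ℚ-* : ∀ m n → ℕ→ℚ (m ℕ.* n) ≡ ℕ→ℚ m * ℕ→ℚ n
ℕ→ℚ-* m n = toℚᵘ-injective (begin-equality
  toℚᵘ (ℕ→ℚ (m ℕ.* n))              ≃⟨ toℚᵘ-fromℚᵘ (ℚᵘ.mkℚᵘ (+ (m ℕ.* n)) 0) ⟩
  ℚᵘ.mkℚᵘ (+ (m ℕ.* n)) 0            ≃⟨ ℚᵘ.*≡* (cong (ℤ._* + 1) (ℤₚ.pos-* m n)) ⟩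
  ℚᵘ.mkℚᵘ (+ m) 0 ℚᵘ.* ℚᵘ.mkℚᵘ (+ n) 0 ≃⟨ ℚᵘₚ.*-cong (toℚᵘ-fromℚᵘ (ℚᵘ.mkℚᵘ (+ m) 0)) (toℚᵘ-fromℚᵘ (ℚᵘ.mkℚᵘ (+ n) 0)) ⟨
  toℚᵘ (ℕ→ℚ m) ℚᵘ.* toℚᵘ (ℕ→ℚ n)      ≃⟨ toℚᵘ-homo-* (ℕ→ℚ m) (ℕ→ℚ n) ⟨
  toℚᵘ (ℕ→ℚ m * ℕ→ℚ n)              ∎)
  where open ℚᵘₚ.≤-Reasoning

ℕ→ℚ*recip≡1 : ∀ n .{{_ : NonZero n}} → ℕ→ℚ n * recip n ≡ 1ℚ
ℕ→ℚ*recip≡1 (suc n) = toℚᵘ-injective (begin-equality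
  toℚᵘ (ℕ→ℚ (suc n) * recip (suc n))                ≃⟨ toℚᵘ-homo-* (ℕ→ℚ (suc n)) (recip (suc n)) ⟩
  toℚᵘ (ℕ→ℚ (suc n)) ℚᵘ.* toℚᵘ (recip (suc n))     ≃⟨ ℚᵘₚ.*-cong (toℚᵘ-fromℚᵘ (ℚᵘ.mkℚᵘ (+ suc n) 0))
                                                                   (toℚᵘ-fromℚᵘ (ℚᵘ.mkℚᵘ (+ 1) n)) ⟩
  ℚᵘ.mkℚᵘ (+ suc n) 0 ℚᵘ.* ℚᵘ.mkℚᵘ (+ 1) n          ≃⟨ ℚᵘ.*≡* cross ⟩
  ℚᵘ.1ℚᵘ                                             ∎)
  where
  open ℚᵘₚ.≤-Reasoning
  cross : + suc n ℤ.* + 1 ℤ.* + 1 ≡ + 1 ℤ.* + (1 ℕ.* suc n)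
  cross = trans (ℤₚ.*-identityʳ _) (trans (ℤₚ.*-identityʳ _)
            (sym (trans (ℤₚ.*-identityˡ _) (cong +_ (ℕₚ.*-identityˡ (suc n))))))

ℕ→ℚ*recip≡recip : ∀ a b c .{{_ : NonZero b}} .{{_ : NonZero c}} → a ℕ.* b ≡ c → ℕ→ℚ a * recip c ≡ recip b
ℕ→ℚ*recip≡recip a b c ab≡c = begin
  ℕ→ℚ a * recip c                              ≡⟨ *-identityʳ _ ⟨
  ℕ→ℚ a * recip c * 1ℚ                         ≡⟨ cong (ℕ→ℚ a * recip c *_) (ℕ→ℚ*recip≡1 b) ⟨
  ℕ→ℚ a * recip c * (ℕ→ℚ b * recip b)          ≡⟨ solve 4 (λ a c b b⁻¹ → a :* c :* (b :* b⁻¹) := a :* b :* c :* b⁻¹) refl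
                                                      (ℕ→ℚ a) (recip c) (ℕ→ℚ b) (recip b) ⟩
  ℕ→ℚ a * ℕ→ℚ b * recip c * recip b            ≡⟨ cong (λ x → x * recip c * recip b) (trans (cong ℕ→ℚ (sym ab≡c)) (ℕ→ℚ-* a b)) ⟨
  ℕ→ℚ c * recip c * recip b                    ≡⟨ cong (_* recip b) (ℕ→ℚ*recip≡1 c) ⟩
  1ℚ * recip b                                 ≡⟨ *-identityˡ _ ⟩
  recip b                                      ∎
  where open ≡-Reasoning

recip-* : ∀ m n .{{_ : NonZero m}} .{{_ : NonZero n}} → recip (m ℕ.* n) ≡ recip m * recip n
recip-* m n = begin
  recip (m ℕ.* n)                      ≡⟨ *-identityʳ _ ⟨
  recip (m ℕ.* n) * 1ℚ                 ≡⟨ cong (recip (m ℕ.* n) *_) (ℕ→ℚ*recip≡1 n) ⟨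
  recip (m ℕ.* n) * (ℕ→ℚ n * recip n)  ≡⟨ *-assoc (recip (m ℕ.* n)) (ℕ→ℚ n) (recip n) ⟨
  recip (m ℕ.* n) * ℕ→ℚ n * recip n    ≡⟨ cong (_* recip n) (trans (*-comm (recip (m ℕ.* n)) (ℕ→ℚ n)) nm⁻¹≡m⁻¹) ⟩
  recip m * recip n                    ∎
  where
  open ≡-Reasoning
  instance _ = ℕₚ.m*n≢0 m n
  nm⁻¹≡m⁻¹ : ℕ→ℚ n * recip (m ℕ.* n) ≡ recip m
  nm⁻¹≡m⁻¹ = ℕ→ℚ*recip≡recip n m (m ℕ.* n) (ℕₚ.*-comm n m)

sgn-+ : ∀ m n → sgn (m ℕ.+ n) ≡ sgn m * sgn n
sgn-+ zero    n = sym (*-identityˡ (sgn n))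
sgn-+ (suc m) n = trans (cong -_ (sgn-+ m n)) (neg-distribˡ-* (sgn m) (sgn n))

ε : ℕ → ℚ
ε n = sgn n * recip (n !)

ε-suc : ∀ n → ε n * recip (suc n) ≡ - ε (suc n)
ε-suc n = begin
  sgn n * recip (n !) * recip (suc n)          ≡⟨ solve 3 (λ s r r′ → s :* r :* r′ := :- ((:- s) :* (r′ :* r))) refl
                                                    (sgn n) (recip (n !)) (recip (suc n)) ⟩
  - (- sgn n * (recip (suc n) * recip (n !)))  ≡⟨ cong (λ x → - (- sgn n * x)) (recip-* (suc n) (n !) {{_}} {{n ℕₚ.!≢0}}) ⟨
  - ε (suc n)                                  ∎
  where open ≡-Reasoning

nCk*k!*[n∸k]!≡n! : ∀ {n k} → k ≤ n → (n C k) ℕ.* (k ! ℕ.* (n ∸ k) !) ≡ n !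
nCk*k!*[n∸k]!≡n! {n} {k} k≤n = trans (cong (ℕ._* (k ! ℕ.* (n ∸ k) !)) (nCk≡n!/k![n-k]! k≤n))
                                      (m/n*n≡m {{k ℕₚ.!* (n ∸ k) !≢0}} (k![n∸k]!∣n! k≤n))

ε-binomial : ∀ {n k} → k ≤ n → ℕ→ℚ (n C k) * ε n ≡ ε k * ε (n ∸ k)
ε-binomial {n} {k} k≤n = begin
  ℕ→ℚ (n C k) * (sgn n * recip (n !))          ≡⟨ solve 3 (λ c s r → c :* (s :* r) := s :* (c :* r)) refl
                                                    (ℕ→ℚ (n C k)) (sgn n) (recip (n !)) ⟩
  sgn n * (ℕ→ℚ (n C k) * recip (n !))          ≡⟨ cong₂ _*_ sgn-split factorial-split ⟩
  sgn k * sgn l * (recip (k !) * recip (l !))  ≡⟨ solve 4 (λ s s′ r r′ → s :* s′ :* (r :* r′) := s :* r :* (s′ :* r′)) refl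
                                                    (sgn k) (sgn l) (recip (k !)) (recip (l !)) ⟩
  ε k * ε l                                    ∎
  where
  open ≡-Reasoning
  l = n ∸ k
  sgn-split : sgn n ≡ sgn k * sgn l
  sgn-split = trans (cong sgn (sym (ℕₚ.m+[n∸m]≡n k≤n))) (sgn-+ k l)
  factorial-split : ℕ→ℚ (n C k) * recip (n !) ≡ recip (k !) * recip (l !)
  factorial-split = trans (ℕ→ℚ*recip≡recip (n C k) (k ! ℕ.* l !) (n !) {{k ℕₚ.!* l !≢0}} {{n ℕₚ.!≢0}} (nCk*k!*[n∸k]!≡n! k≤n))
                          (recip-* (k !) (l !) {{k ℕₚ.!≢0}} {{l ℕₚ.!≢0}})

sumTo-zero : ∀ n (f : ℕ → ℚ) → (∀ i → f i ≡ 0ℚ) → sumTo n f ≡ 0ℚ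
sumTo-zero zero    f f≡0 = f≡0 0
sumTo-zero (suc n) f f≡0 = trans (cong₂ _+_ (sumTo-zero n f f≡0) (f≡0 (suc n))) (+-identityˡ 0ℚ)

sumTo-head : ∀ n (f : ℕ → ℚ) → (∀ i → f (suc i) ≡ 0ℚ) → sumTo n f ≡ f 0
sumTo-head zero    f _      = refl
sumTo-head (suc n) f tail≡0 = trans (cong₂ _+_ (sumTo-head n f tail≡0) (tail≡0 n)) (+-identityʳ (f 0))

sumTo-suc : ∀ n (f : ℕ → ℚ) → sumTo (suc n) f ≡ f 0 + sumTo n (λ i → f (suc i))
sumTo-suc zero    f = refl
sumTo-suc (suc n) f = trans (cong (_+ f (suc (suc n))) (sumTo-suc n f)) (+-assoc (f 0) _ _)

sumTo-cong : ∀ n (f g : ℕ → ℚ) → (∀ i → i ≤ n → f i ≡ g i) → sumTo n f ≡ sumTo n g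
sumTo-cong zero    f g f≡g = f≡g 0 ℕ.z≤n
sumTo-cong (suc n) f g f≡g =
  cong₂ _+_ (sumTo-cong n f g (λ i i≤n → f≡g i (ℕₚ.m≤n⇒m≤1+n i≤n))) (f≡g (suc n) ℕₚ.≤-refl)

sumTo-reverse : ∀ n (f : ℕ → ℚ) → sumTo n f ≡ sumTo n (λ i → f (n ∸ i))
sumTo-reverse zero    f = refl
sumTo-reverse (suc n) f = begin
  sumTo n f + f (suc n)                          ≡⟨ cong (_+ f (suc n)) (sumTo-reverse n f) ⟩
  sumTo n (λ i → f (n ∸ i)) + f (suc n)          ≡⟨ +-comm _ (f (suc n)) ⟩
  f (suc n) + sumTo n (λ i → f (n ∸ i))          ≡⟨ sumTo-suc n (λ i → f (suc n ∸ i)) ⟨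
  sumTo (suc n) (λ i → f (suc n ∸ i))            ∎
  where open ≡-Reasoning

*-distribˡ-sumTo : ∀ n c (f : ℕ → ℚ) → c * sumTo n f ≡ sumTo n (λ i → c * f i)
*-distribˡ-sumTo zero    c f = refl
*-distribˡ-sumTo (suc n) c f = trans (*-distribˡ-+ c _ _) (cong (_+ c * f (suc n)) (*-distribˡ-sumTo n c f))

neg-distrib-sumTo : ∀ n (f : ℕ → ℚ) → - sumTo n f ≡ sumTo n (λ i → - f i)
neg-distrib-sumTo zero    f = refl
neg-distrib-sumTo (suc n) f =
  trans (neg-distrib-+ (sumTo n f) (f (suc n))) (cong (_+ - f (suc n)) (neg-distrib-sumTo n f))

*ₛ-zeroˡ : ∀ {r} (f g : PS r) → (∀ u → f u ≡ 0ℚ) → ∀ v → (f *ₛ g) v ≡ 0ℚ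
*ₛ-zeroˡ f g f≡0 []      = trans (cong (_* g []) (f≡0 [])) (*-zeroˡ (g []))
*ₛ-zeroˡ f g f≡0 (n ∷ v) =
  sumTo-zero n _ (λ i → *ₛ-zeroˡ (λ u → f (i ∷ u)) (λ u → g ((n ∸ i) ∷ u)) (λ u → f≡0 (i ∷ u)) v)

*ₛ-head : ∀ {r} (f g : PS (suc r)) → (∀ i u → f (suc i ∷ u) ≡ 0ℚ) →
          ∀ x v → (f *ₛ g) (x ∷ v) ≡ ((λ u → f (0 ∷ u)) *ₛ (λ u → g (x ∷ u))) v
*ₛ-head f g f≡0 x v = sumTo-head x _ (λ i → *ₛ-zeroˡ _ _ (f≡0 i) v)

lastVar-*ₛ-zero : ∀ {k} (g : PS (suc k)) (v : Vec ℕ k) → (lastVar *ₛ g) (v ∷ʳ 0) ≡ 0ℚ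
lastVar-*ₛ-zero {zero}  g []      = *-zeroˡ (g (0 ∷ []))
lastVar-*ₛ-zero {suc k} g (x ∷ v) =
  trans (*ₛ-head lastVar g (λ _ _ → refl) x (v ∷ʳ 0)) (lastVar-*ₛ-zero (λ u → g (x ∷ u)) v)

lastVar-*ₛ-suc : ∀ {k} (g : PS (suc k)) (v : Vec ℕ k) n → (lastVar *ₛ g) (v ∷ʳ suc n) ≡ g (v ∷ʳ n)
lastVar-*ₛ-suc {zero}  g []      n =
  trans (sumTo-suc n _)
        (trans (cong₂ _+_ (*-zeroˡ (g (suc n ∷ [])))
                          (sumTo-head n (λ i → lastVar (suc i ∷ []) * g ((n ∸ i) ∷ []))
                                        (λ i → *-zeroˡ (g ((n ∸ suc i) ∷ [])))))
               (trans (+-identityˡ _) (*-identityˡ (g (n ∷ [])))))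
lastVar-*ₛ-suc {suc k} g (x ∷ v) n =
  trans (*ₛ-head lastVar g (λ _ _ → refl) x (v ∷ʳ suc n)) (lastVar-*ₛ-suc (λ u → g (x ∷ u)) v n)

inLast-*ₛ : ∀ {k} h (g : PS (suc k)) (v : Vec ℕ k) n →
            (inLast h *ₛ g) (v ∷ʳ n) ≡ sumTo n (λ i → h i * g (v ∷ʳ (n ∸ i)))
inLast-*ₛ {zero}  h g []      n = refl
inLast-*ₛ {suc k} h g (x ∷ v) n =
  trans (*ₛ-head (inLast h) g (λ _ _ → refl) x (v ∷ʳ n)) (inLast-*ₛ h (λ u → g (x ∷ u)) v n)

extendLast-zero : ∀ {k} (f : PS k) v → extendLast f (v ∷ʳ 0) ≡ f v
extendLast-zero f v rewrite Vecₚ.last-∷ʳ 0 v | Vecₚ.init-∷ʳ 0 v = refl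

extendLast-suc : ∀ {k} (f : PS k) v n → extendLast f (v ∷ʳ suc n) ≡ 0ℚ
extendLast-suc f v n rewrite Vecₚ.last-∷ʳ (suc n) v = refl

substLast-∷ʳ : ∀ {k} (g : PS (suc k)) (v : Vec ℕ k) a b →
               substLast g ((v ∷ʳ a) ∷ʳ b) ≡ ℕ→ℚ ((a ℕ.+ b) C a) * g (v ∷ʳ (a ℕ.+ b))
substLast-∷ʳ g v a b rewrite Vecₚ.init-∷ʳ b (v ∷ʳ a) | Vecₚ.last-∷ʳ b (v ∷ʳ a)
                           | Vecₚ.init-∷ʳ a v | Vecₚ.last-∷ʳ a v = refl

module _ {A : Set} {_∙_ : A → A → A} {e : A} (isMonoid : IsMonoid _≡_ _∙_ e) where
  open IsMonoid isMonoid using (assoc; identityˡ; identityʳ)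

  foldr-∷ʳ-monoid : ∀ {k} (p : Vec A k) c → Vec.foldr _ _∙_ e (p ∷ʳ c) ≡ Vec.foldr _ _∙_ e p ∙ c
  foldr-∷ʳ-monoid []      c = trans (identityʳ c) (sym (identityˡ c))
  foldr-∷ʳ-monoid (x ∷ p) c = trans (cong (x ∙_) (foldr-∷ʳ-monoid p c)) (sym (assoc x _ c))

∏! : ∀ {k} → Vec ℕ k → ℕ
∏! p = Vec.foldr _ ℕ._*_ 1 (Vec.map _! p)

∏!-nonZero : ∀ {k} (p : Vec ℕ k) → NonZero (∏! p)
∏!-nonZero []      = _
∏!-nonZero (x ∷ p) = ℕₚ.m*n≢0 (x !) (∏! p) {{x ℕₚ.!≢0}} {{∏!-nonZero p}}

∏!-∷ʳ : ∀ {k} (p : Vec ℕ k) c → ∏! (p ∷ʳ c) ≡ ∏! p ℕ.* c !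
∏!-∷ʳ p c = trans (cong (Vec.foldr _ ℕ._*_ 1) (Vecₚ.map-∷ʳ _! c p))
                  (foldr-∷ʳ-monoid ℕₚ.*-1-isMonoid (Vec.map _! p) (c !))

εᵛ : ∀ {k} → Vec ℕ k → ℚ
εᵛ p = sgn (Vec.sum p) * recip (∏! p)

εᵛ-∷ʳ : ∀ {k} (p : Vec ℕ k) c → εᵛ (p ∷ʳ c) ≡ εᵛ p * ε c
εᵛ-∷ʳ p c = begin
  sgn (Vec.sum (p ∷ʳ c)) * recip (∏! (p ∷ʳ c))         ≡⟨ cong₂ (λ s q → sgn s * recip q)
                                                             (foldr-∷ʳ-monoid ℕₚ.+-0-isMonoid p c) (∏!-∷ʳ p c) ⟩
  sgn (Vec.sum p ℕ.+ c) * recip (∏! p ℕ.* c !)         ≡⟨ cong₂ _*_ (sgn-+ (Vec.sum p) c)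
                                                             (recip-* (∏! p) (c !) {{∏!-nonZero p}} {{c ℕₚ.!≢0}}) ⟩
  sgn (Vec.sum p) * sgn c * (recip (∏! p) * recip (c !)) ≡⟨ solve 4 (λ s s′ r r′ → s :* s′ :* (r :* r′) := s :* r :* (s′ :* r′))
                                                              refl (sgn (Vec.sum p)) (sgn c) (recip (∏! p)) (recip (c !)) ⟩
  εᵛ p * ε c                                           ∎
  where open ≡-Reasoning

reverse-∷ʳ : ∀ {A : Set} {k} x (xs : Vec A k) → Vec.reverse (xs ∷ʳ x) ≡ x ∷ Vec.reverse xs
reverse-∷ʳ x xs = Vecₚ.reverse-reverse (trans (Vecₚ.reverse-∷ x (Vec.reverse xs))
                                              (cong (_∷ʳ x) (Vecₚ.reverse-involutive xs)))

V-∷ʳ : ∀ {k} (p : Vec ℕ k) x → V (p ∷ʳ x) ≡ Vrev x (Vec.toList (Vec.reverse p))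
V-∷ʳ p x rewrite reverse-∷ʳ x p = refl

-- Vrev takes the leading arguments of V, shifted by one, in reverse order.
revSucs : ∀ {k} → Vec ℕ k → List ℕ
revSucs p = Vec.toList (Vec.reverse (Vec.map suc p))

revSucs-∷ʳ : ∀ {k} (p : Vec ℕ k) a → revSucs (p ∷ʳ a) ≡ suc a ∷ revSucs p
revSucs-∷ʳ p a rewrite Vecₚ.map-∷ʳ suc a p | reverse-∷ʳ (suc a) (Vec.map suc p) = refl

F-∷ʳ : ∀ {k} (p : Vec ℕ k) c → F k (p ∷ʳ c) ≡ εᵛ p * ε c * Vrev (suc c) (revSucs p)
F-∷ʳ p c = begin
  sgn (Vec.sum n) * V (Vec.map suc n) * recip (∏! n) ≡⟨ solve 3 (λ s v r → s :* v :* r := s :* r :* v) refl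
                                                          (sgn (Vec.sum n)) (V (Vec.map suc n)) (recip (∏! n)) ⟩
  εᵛ n * V (Vec.map suc n)                           ≡⟨ cong₂ _*_ (εᵛ-∷ʳ p c) (trans (cong V (Vecₚ.map-∷ʳ suc c p))
                                                                                      (V-∷ʳ (Vec.map suc p) (suc c))) ⟩
  εᵛ p * ε c * Vrev (suc c) (revSucs p)              ∎
  where
  open ≡-Reasoning
  n = p ∷ʳ c

F₁-recurrence : (lastVar *ₛ F 0) ≈ₛ (oneₛ -ₛ inLast FBneg)
F₁-recurrence (zero  ∷ []) = lastVar-*ₛ-zero (F 0) []
F₁-recurrence (suc m ∷ []) = begin
  (lastVar *ₛ F 0) (suc m ∷ [])               ≡⟨ lastVar-*ₛ-suc (F 0) [] m ⟩
  F 0 ([] ∷ʳ m)                               ≡⟨ F-∷ʳ [] m ⟩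
  εᵛ [] * ε m * (B (suc m) * recip (suc m))   ≡⟨ cong (_* (B (suc m) * recip (suc m))) (*-identityˡ (ε m)) ⟩
  ε m * (B (suc m) * recip (suc m))           ≡⟨ solve 3 (λ e b r → e :* (b :* r) := b :* (e :* r)) refl
                                                   (ε m) (B (suc m)) (recip (suc m)) ⟩
  B (suc m) * (ε m * recip (suc m))           ≡⟨ cong (B (suc m) *_) (ε-suc m) ⟩
  B (suc m) * - ε (suc m)                     ≡⟨ solve 3 (λ b s r → b :* (:- (s :* r)) := con 0ℚ :+ :- (s :* b :* r)) refl
                                                   (B (suc m)) (sgn (suc m)) (recip (suc m !)) ⟩
  (oneₛ -ₛ inLast FBneg) (suc m ∷ [])         ∎
  where open ≡-Reasoning

substLast-∷ʳ-zero : ∀ {k} (g : PS (suc k)) (p : Vec ℕ k) a → substLast g ((p ∷ʳ a) ∷ʳ 0) ≡ g (p ∷ʳ a)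
substLast-∷ʳ-zero g p a rewrite substLast-∷ʳ g p a 0 | ℕₚ.+-identityʳ a | nCn≡1 a = *-identityˡ (g (p ∷ʳ a))

module _ {k} (p : Vec ℕ k) (a : ℕ) where
  open ≡-Reasoning

  private
    v = p ∷ʳ a
    L = lastVar *ₛ F (suc k)
    R = extendLast (F k) -ₛ (inLast FBneg *ₛ substLast (F k))

  F-recurrence-zero : L (v ∷ʳ 0) ≡ R (v ∷ʳ 0)
  F-recurrence-zero = begin
    L (v ∷ʳ 0)       ≡⟨ lastVar-*ₛ-zero (F (suc k)) v ⟩
    0ℚ               ≡⟨ +-inverseʳ (F k v) ⟨
    F k v + - F k v  ≡⟨ cong₂ (λ x y → x + - y) (extendLast-zero (F k) v) convolution≡F ⟨
    R (v ∷ʳ 0)       ∎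
    where
    convolution≡F : (inLast FBneg *ₛ substLast (F k)) (v ∷ʳ 0) ≡ F k v
    convolution≡F = trans (inLast-*ₛ FBneg (substLast (F k)) v 0)
                          (trans (*-identityˡ (substLast (F k) (v ∷ʳ 0))) (substLast-∷ʳ-zero (F k) p a))

  F-recurrence-suc : ∀ m → L (v ∷ʳ suc m) ≡ R (v ∷ʳ suc m)
  F-recurrence-suc m = begin
    L (v ∷ʳ M)                                      ≡⟨ lastVar-*ₛ-suc (F (suc k)) v m ⟩
    F (suc k) (v ∷ʳ m)                              ≡⟨ F-∷ʳ v m ⟩
    εᵛ v * ε m * Vrev M (revSucs v)                 ≡⟨ cong₂ (λ e l → e * ε m * Vrev M l) (εᵛ-∷ʳ p a) (revSucs-∷ʳ p a) ⟩
    εᵛ p * ε a * ε m * (recip M * sumTo M G)        ≡⟨ solve 5 (λ e e′ e″ r s → e :* e′ :* e″ :* (r :* s) := e :* e′ :* (e″ :* r) :* s)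
                                                          refl (εᵛ p) (ε a) (ε m) (recip M) (sumTo M G) ⟩
    K * sumTo M G                                   ≡⟨ *-distribˡ-sumTo M K G ⟩
    sumTo M (λ j → K * G j)                         ≡⟨ sumTo-cong M _ _ term ⟩
    sumTo M (λ j → - T (M ∸ j))                     ≡⟨ sumTo-reverse M (λ i → - T i) ⟨
    sumTo M (λ i → - T i)                           ≡⟨ neg-distrib-sumTo M T ⟨
    - sumTo M T                                     ≡⟨ cong -_ (inLast-*ₛ FBneg (substLast (F k)) v M) ⟨
    - (inLast FBneg *ₛ substLast (F k)) (v ∷ʳ M)    ≡⟨ +-identityˡ _ ⟨
    0ℚ + - (inLast FBneg *ₛ substLast (F k)) (v ∷ʳ M) ≡⟨ cong (_+ - (inLast FBneg *ₛ substLast (F k)) (v ∷ʳ M))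
                                                           (extendLast-suc (F k) v m) ⟨
    R (v ∷ʳ M)                                      ∎
    where
    M = suc m
    X : ℕ → ℚ
    X j = Vrev (suc a ℕ.+ j) (revSucs p)
    G : ℕ → ℚ
    G j = ℕ→ℚ (M C j) * B (M ∸ j) * X j
    K : ℚ
    K = εᵛ p * ε a * (ε m * recip M)
    T : ℕ → ℚ
    T i = FBneg i * substLast (F k) (v ∷ʳ (M ∸ i))

    term : ∀ j → j ≤ M → K * G j ≡ - T (M ∸ j)
    term j j≤M = begin
      K * G j                                            ≡⟨ cong (λ e → εᵛ p * ε a * e * G j) (ε-suc m) ⟩
      εᵛ p * ε a * - ε M * (c * B i * X j)              ≡⟨ solve 6 (λ E e′ e c b x → E :* e′ :* (:- e) :* (c :* b :* x)
                                                                                 := :- (E :* e′ :* b :* x :* (c :* e)))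
                                                              refl (εᵛ p) (ε a) (ε M) c (B i) (X j) ⟩
      - (εᵛ p * ε a * B i * X j * (c * ε M))            ≡⟨ cong (λ z → - (εᵛ p * ε a * B i * X j * z)) (ε-binomial j≤M) ⟩
      - (εᵛ p * ε a * B i * X j * (ε j * ε i))          ≡⟨ solve 7 (λ E e′ b x s r ej → :- (E :* e′ :* b :* x :* (ej :* (s :* r)))
                                                                   := :- ((s :* b :* r) :* (E :* x :* (e′ :* ej))))
                                                              refl (εᵛ p) (ε a) (B i) (X j) (sgn i) (recip (i !)) (ε j) ⟩
      - (FBneg i * (εᵛ p * X j * (ε a * ε j)))          ≡⟨ cong (λ z → - (FBneg i * (εᵛ p * X j * z))) a+j-split ⟨
      - (FBneg i * (εᵛ p * X j * (c′ * ε (a ℕ.+ j))))   ≡⟨ cong (λ z → - (FBneg i * z)) substLast≡ ⟨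
      - T i                                              ∎
      where
      i = M ∸ j
      c = ℕ→ℚ (M C j)
      c′ = ℕ→ℚ ((a ℕ.+ j) C a)
      a+j-split : c′ * ε (a ℕ.+ j) ≡ ε a * ε j
      a+j-split = trans (ε-binomial (ℕₚ.m≤m+n a j)) (cong (λ b → ε a * ε b) (ℕₚ.m+n∸m≡n a j))
      substLast≡ : substLast (F k) (v ∷ʳ (M ∸ i)) ≡ εᵛ p * X j * (c′ * ε (a ℕ.+ j))
      substLast≡ = begin
        substLast (F k) (v ∷ʳ (M ∸ i))                  ≡⟨ cong (λ b → substLast (F k) (v ∷ʳ b)) (ℕₚ.m∸[m∸n]≡n j≤M) ⟩
        substLast (F k) (v ∷ʳ j)                        ≡⟨ substLast-∷ʳ (F k) p a j ⟩
        c′ * F k (p ∷ʳ (a ℕ.+ j))                        ≡⟨ cong (c′ *_) (F-∷ʳ p (a ℕ.+ j)) ⟩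
        c′ * (εᵛ p * ε (a ℕ.+ j) * X j)                  ≡⟨ solve 4 (λ c E e x → c :* (E :* e :* x) := E :* x :* (c :* e))
                                                               refl c′ (εᵛ p) (ε (a ℕ.+ j)) (X j) ⟩
        εᵛ p * X j * (c′ * ε (a ℕ.+ j))                  ∎

  F-recurrence : ∀ M → L (v ∷ʳ M) ≡ R (v ∷ʳ M)
  F-recurrence zero    = F-recurrence-zero
  F-recurrence (suc m) = F-recurrence-suc m

∷ʳ-∷ʳ-elim : ∀ {A : Set} {n} (P : Vec A (suc (suc n)) → Set) →
             (∀ xs x y → P ((xs ∷ʳ x) ∷ʳ y)) → ∀ v → P v
∷ʳ-∷ʳ-elim P P-∷ʳ v with Vec.initLast v
... | w , y , refl with Vec.initLast w
...   | xs , x , refl = P-∷ʳ xs x y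

theorem6 : ((lastVar *ₛ F 0) ≈ₛ (oneₛ -ₛ inLast FBneg))
           × ((k : ℕ) → (lastVar *ₛ F (suc k)) ≈ₛ (extendLast (F k) -ₛ (inLast FBneg *ₛ substLast (F k))))
theorem6 = F₁-recurrence , λ k → ∷ʳ-∷ʳ-elim (Recurrence k) F-recurrence
  where
  Recurrence : ∀ k → Vec ℕ (suc (suc k)) → Set
  Recurrence k v = (lastVar *ₛ F (suc k)) v ≡ (extendLast (F k) -ₛ (inLast FBneg *ₛ substLast (F k))) v
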